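{- Let $G$ be a finite forest (a simple graph with no cycles) and $f_1, f_2 : G \to \mathbb{R}$ (excellent) discrete Morse functions, and let $q \in \{0,1\}$. Let $\tilde{\sigma}^{(q)}_1$ be a $q$-dimensional critical simplex of $f_1$ and $\tilde{\sigma}^{(q)}_2$ a $q$-dimensional critical simplex of $f_2$. If $\tilde{\sigma}_1$ is strongly connected to $\tilde{\sigma}_2$, then $\tilde{\sigma}_1$ is not strongly connected to any other critical simplex of $f_2$, and $\tilde{\sigma}_2$ is not strongly connected to any other critical simplex of $f_1$. Moreover, the gradient path connecting $\tilde{\sigma}_1$ to $\tilde{\sigma}_2$ and the gradient path connecting $\tilde{\sigma}_2$ to $\tilde{\sigma}_1$ are unique.
   Context: A simple graph is regarded as a 1-dimensional simplicial complex; $v \prec e$ means $v$ is an endpoint of $e$. A discrete Morse function on $G$ is $f: G \to \mathbb{R}$ on vertices and edges such that each vertex $v$ has at most one incident edge $e$ with $f(e) \le f(v)$, and each edge $e$ has at most one endpoint $v$ with $f(e) \le f(v)$. A simplex is critical if no such edge (for a vertex) or endpoint (for an edge) exists; $f$ is excellent if critical values are distinct. The gradient vector field $V$ of $f$ is the set of pairs $(v,e)$ with $v \prec e$ and $f(v)\ge f(e)$. A $V$-path from a vertex $v_0$ to a vertex $v_{r+1}$ is a sequence $v_0, e_0, v_1, \ldots, e_r, v_{r+1}$ with $(v_i, e_i) \in V$, $v_{i+1} \prec e_i$, $v_{i+1} \ne v_i$; a $V$-path from an edge $e_0$ to an edge $e_r$ is a sequence $e_0, v_1, e_1, \ldots,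 v_r, e_r$ with $v_i \prec e_{i-1}$, $(v_i,e_i) \in V$, and consecutive vertices distinct; a single simplex is a trivial path. Let $V_1,V_2$ be the gradient vector fields of $f_1,f_2$. For an $f_1$-critical vertex $v_1$ and an $f_2$-critical vertex $v_2$: $v_1$ is connected to $v_2$ if there is a $V_2$-path from $v_1$ to $v_2$, and $v_2$ is connected to $v_1$ if there is a $V_1$-path from $v_2$ to $v_1$. For an $f_1$-critical edge $e_1$ and an $f_2$-critical edge $e_2$: $e_1$ is connected to $e_2$ if there is a $V_1$-path from $e_1$ to $e_2$, and $e_2$ is connected to $e_1$ if there is a $V_2$-path from $e_2$ to $e_1$. These paths are the gradient paths connecting them. Two such simplices are strongly connected if each is connected to the other (a simplex critical for both functions is strongly connected to itself via the trivial path). -}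

module Defs where

open import Level using (0ℓ)
open import Data.Nat using (ℕ; suc)
open import Data.Fin using (Fin; zero; suc; inject₁; fromℕ)
open import Data.Sum using (_⊎_; inj₁; inj₂)
open import Data.Product using (_×_; _,_; ∃; ∃-syntax)
open import Data.List using (List; []; _∷_)
open import Relation.Nullary using (¬_)
open import Relation.Binary.Bundles using (TotalOrder)
open import Relation.Binary.PropositionalEquality using (_≡_; _≢_)
open import Function.Definitions using (Injective)

-- Finite simple graphs, regarded as 1-dimensional simplicial complexes.

record Graph : Set where
  field
    n m      : ℕ
    src tgt  : Fin m → Fin n
    loopless : ∀ e → src e ≢ tgt e
    noMulti  : ∀ e e' →
               ((src e ≡ src e' × tgt e ≡ tgt e') ⊎ (src e ≡ tgt e' × tgt e ≡ src e'))
               → e ≡ e'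

module _ (G : Graph) where
  open Graph G

  _≺_ : Fin n → Fin m → Set
  v ≺ e = (v ≡ src e) ⊎ (v ≡ tgt e)

  Adjacent : Fin n → Fin n → Set
  Adjacent u w = ∃[ e ] (u ≺ e × w ≺ e)

  record Cycle : Set where
    field
      k     : ℕ
      vs    : Fin (suc (suc (suc k))) → Fin n
      inj   : Injective _≡_ _≡_ vs
      adj   : ∀ (i : Fin (suc (suc k))) → Adjacent (vs (inject₁ i)) (vs (suc i))
      close : Adjacent (vs (fromℕ (suc (suc k)))) (vs zero)

  Forest : Set
  Forest = ¬ Cycle

  Simplex : Set
  Simplex = Fin n ⊎ Fin m

  Cell : Fin 2 → Set
  Cell zero       = Fin n
  Cell (suc zero) = Fin m

  dimSimplex : (q : Fin 2) → Cell q → Simplex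
  dimSimplex zero       v = inj₁ v
  dimSimplex (suc zero) e = inj₂ e

-- Discrete Morse theory on G with values in a total order O
-- (the paper uses ℝ).

module Morse (O : TotalOrder 0ℓ 0ℓ 0ℓ) (G : Graph) where
  open Graph G
  open TotalOrder O renaming (Carrier to R)

  Fn : Set
  Fn = Simplex G → R

  module _ (f : Fn) where

    fv : Fin n → R
    fv v = f (inj₁ v)

    fe : Fin m → R
    fe e = f (inj₂ e)

    record IsDiscreteMorse : Set where
      field
        vertexCond : ∀ v e e' → _≺_ G v e → fe e ≤ fv v
                              → _≺_ G v e' → fe e' ≤ fv v → e ≡ e'
        edgeCond   : ∀ e v v' → _≺_ G v e → fe e ≤ fv v
                              → _≺_ G v' e → fe e ≤ fv v' → v ≡ v'

    CriticalVertex : Fin n → Set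
    CriticalVertex v = ¬ (∃[ e ] (_≺_ G v e × fe e ≤ fv v))

    CriticalEdge : Fin m → Set
    CriticalEdge e = ¬ (∃[ v ] (_≺_ G v e × fe e ≤ fv v))

    CriticalSimplex : Simplex G → Set
    CriticalSimplex (inj₁ v) = CriticalVertex v
    CriticalSimplex (inj₂ e) = CriticalEdge e

    Critical : (q : Fin 2) → Cell G q → Set
    Critical zero       v = CriticalVertex v
    Critical (suc zero) e = CriticalEdge e

    Excellent : Set
    Excellent = ∀ σ τ → CriticalSimplex σ → CriticalSimplex τ → σ ≢ τ → ¬ (f σ ≈ f τ)

    -- the gradient vector field V of f: (v , e) ∈ V
    InV : Fin n → Fin m → Set
    InV v e = _≺_ G v e × fe e ≤ fv v

    data VPath : Fin n → Fin n → Set where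
      vstop : ∀ v → VPath v v
      vstep : ∀ {v w u} (e : Fin m) → InV v e → _≺_ G w e → w ≢ v
            → VPath w u → VPath v u

    vtrace : ∀ {v u} → VPath v u → List (Simplex G)
    vtrace (vstop v) = inj₁ v ∷ []
    vtrace (vstep {v} e _ _ _ p) = inj₁ v ∷ inj₂ e ∷ vtrace p

    -- tail of an edge V-path: current vertex v paired with edge e,
    -- continuing to the final edge
    data ETail : Fin n → Fin m → Fin m → Set where
      tstop : ∀ {v} e → ETail v e e
      tstep : ∀ {v e w e' er} → _≺_ G w e → w ≢ v → InV w e'
            → ETail w e' er → ETail v e er

    data EPath : Fin m → Fin m → Set where
      estop  : ∀ e → EPath e e
      estart : ∀ {e₀ v e₁ er} → _≺_ G v e₀ → InV v e₁
             → ETail v e₁ er → EPath e₀ er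

    ttrace : ∀ {v e er} → ETail v e er → List (Simplex G)
    ttrace (tstop e) = inj₂ e ∷ []
    ttrace (tstep {e = e} {w = w} _ _ _ p) = inj₂ e ∷ inj₁ w ∷ ttrace p

    etrace : ∀ {e er} → EPath e er → List (Simplex G)
    etrace (estop e) = inj₂ e ∷ []
    etrace (estart {e₀} {v} _ _ p) = inj₂ e₀ ∷ inj₁ v ∷ ttrace p

  module _ (f₁ f₂ : Fn) where

    Path₁₂ : (q : Fin 2) → Cell G q → Cell G q → Set
    Path₁₂ zero       σ₁ σ₂ = VPath f₂ σ₁ σ₂
    Path₁₂ (suc zero) σ₁ σ₂ = EPath f₁ σ₁ σ₂

    Path₂₁ : (q : Fin 2) → Cell G q → Cell G q → Set
    Path₂₁ zero       σ₁ σ₂ = VPath f₁ σ₂ σ₁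
    Path₂₁ (suc zero) σ₁ σ₂ = EPath f₂ σ₂ σ₁

    trace₁₂ : (q : Fin 2) {σ₁ σ₂ : Cell G q} → Path₁₂ q σ₁ σ₂ → List (Simplex G)
    trace₁₂ zero       p = vtrace f₂ p
    trace₁₂ (suc zero) p = etrace f₁ p

    trace₂₁ : (q : Fin 2) {σ₁ σ₂ : Cell G q} → Path₂₁ q σ₁ σ₂ → List (Simplex G)
    trace₂₁ zero       p = vtrace f₁ p
    trace₂₁ (suc zero) p = etrace f₂ p

    StronglyConnected : (q : Fin 2) → Cell G q → Cell G q → Set
    StronglyConnected q σ₁ σ₂ =
      Critical f₁ q σ₁ × Critical f₂ q σ₂ × Path₁₂ q σ₁ σ₂ × Path₂₁ q σ₁ σ₂

-- Walks that alternate between vertices and edges of G without turning back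
-- are walks in the barycentric subdivision, which is again a forest; hence
-- such a walk never repeats a simplex, and two of them with the same ends
-- coincide.  Gradient paths are such walks.
--
-- For vertices (q = 0) a V-path is determined by its start, which gives all
-- four claims at once.  For edges (q = 1) the V₁-path from σ₁ to σ₂ is the
-- unique walk between them, so the V₂-path back is its reverse.  Read
-- backwards, that V₂-path ends with a vertex x V₂-paired with σ₁, and x is
-- determined by σ₁; so every V₁-path from σ₁ to an f₂-critical partner starts
-- with the same vertex and then proceeds deterministically.  Two partners are
-- therefore met one after the other, and the V₂-path back from the farther
-- one would pair the nearer one, which is f₂-critical.
module Submission where

open import Defs hiding (_≺_)
import Defs
open import Level using (0ℓ)
open import Function using (_∘_)
open import Data.Empty using (⊥; ⊥-elim)
open import Data.Unit using (⊤; tt)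
open import Data.Fin using (Fin; zero; suc; inject₁; fromℕ)
import Data.Fin.Properties as Fin
open import Data.Sum as Sum using (_⊎_; inj₁; inj₂)
open import Data.Sum.Properties using (inj₁-injective; inj₂-injective; ≡-dec)
open import Data.Product as Product using (_×_; _,_; ∃-syntax; proj₁; proj₂)
open import Data.List using (List; []; _∷_; _++_; [_]; reverse; _ʳ++_; length; lookup)
open import Data.List.Properties using (++-assoc; reverse-++; reverse-involutive; ʳ++-defn; unfold-reverse)
open import Data.List.Membership.Propositional using (_∈_; _∉_)
open import Data.List.Membership.Propositional.Properties using (∈-∃++; ∈-lookup; ∈-++⁺ʳ)
open import Data.List.Relation.Unary.Any using (here; there)
open import Data.List.Relation.Unary.Any.Properties using (reverse⁺)
import Data.List.Relation.Unary.All as All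
open import Data.List.Relation.Unary.All.Properties using (¬Any⇒All¬; All¬⇒¬Any) renaming (++⁻ˡ to All-++⁻ˡ)
open import Data.List.Relation.Unary.AllPairs using ([]; _∷_)
open import Data.List.Relation.Unary.Linked using (Linked; []; [-]; _∷_) renaming (tail to Linked-tail)
open import Data.List.Relation.Unary.Unique.Propositional using (Unique)
open import Data.List.Relation.Unary.Unique.Propositional.Properties using (++⁺; Unique[x∷xs]⇒x∉xs)
open import Data.List.Relation.Binary.Disjoint.Propositional using (Disjoint)
open import Relation.Nullary using (¬_; yes; no)
open import Relation.Binary.Bundles using (TotalOrder)
open import Relation.Binary.Core using (Rel)
open import Relation.Binary.PropositionalEquality
  using (_≡_; _≢_; refl; sym; trans; cong; subst; ≢-sym; module ≡-Reasoning)

module _ {A : Set} where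

  NotHeadOf : A → List A → Set
  NotHeadOf x []      = ⊤
  NotHeadOf x (y ∷ _) = x ≢ y

  NotHeadOf-++⁻ˡ : ∀ {x} xs {ys} → NotHeadOf x (xs ++ ys) → NotHeadOf x xs
  NotHeadOf-++⁻ˡ []      _   = tt
  NotHeadOf-++⁻ˡ (_ ∷ _) x≢y = x≢y

  HeadsDiffer : List A → List A → Set
  HeadsDiffer []      _  = ⊤
  HeadsDiffer (x ∷ _) ys = NotHeadOf x ys

  HeadsDiffer-[] : ∀ xs → HeadsDiffer xs []
  HeadsDiffer-[] []      = tt
  HeadsDiffer-[] (_ ∷ _) = tt

  NotHeadOf⇒HeadsDiffer : ∀ {x} ys {zs} → NotHeadOf x ys → HeadsDiffer ys (x ∷ zs)
  NotHeadOf⇒HeadsDiffer []      _   = tt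
  NotHeadOf⇒HeadsDiffer (_ ∷ _) x≢y = ≢-sym x≢y

  Unique-++⁻ˡ : ∀ xs {ys : List A} → Unique (xs ++ ys) → Unique xs
  Unique-++⁻ˡ []       _            = []
  Unique-++⁻ˡ (x ∷ xs) (x∉ ∷ xs++ys!) = All-++⁻ˡ xs x∉ ∷ Unique-++⁻ˡ xs xs++ys!

  Unique-++⇒Disjoint : ∀ xs {ys : List A} → Unique (xs ++ ys) → Disjoint xs ys
  Unique-++⇒Disjoint (x ∷ xs) (x∉ ∷ _) (here refl , x∈ys) = All.lookup x∉ (∈-++⁺ʳ xs x∈ys) refl
  Unique-++⇒Disjoint (x ∷ xs) (_ ∷ u) (there z∈xs , z∈ys) = Unique-++⇒Disjoint xs u (z∈xs , z∈ys)

  Unique-lookup-injective : ∀ {xs : List A} → Unique xs → ∀ i j → lookup xs i ≡ lookup xs j → i ≡ j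
  Unique-lookup-injective (_  ∷ _)  zero    zero    _  = refl
  Unique-lookup-injective (x∉ ∷ _)  zero    (suc j) eq = ⊥-elim (All.lookup x∉ (∈-lookup j) eq)
  Unique-lookup-injective (x∉ ∷ _)  (suc i) zero    eq = ⊥-elim (All.lookup x∉ (∈-lookup i) (sym eq))
  Unique-lookup-injective (_  ∷ u)  (suc i) (suc j) eq = cong suc (Unique-lookup-injective u i j eq)

  reverse-ends : ∀ (x : A) ys z → reverse (x ∷ ys ++ [ z ]) ≡ z ∷ reverse ys ++ [ x ]
  reverse-ends x ys z = trans (unfold-reverse x (ys ++ [ z ])) (cong (_++ [ x ]) (reverse-++ ys [ z ]))

  reverse-middle : ∀ xs (x y : A) ys → reverse (xs ++ x ∷ y ∷ ys) ≡ reverse ys ++ y ∷ x ∷ reverse xs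
  reverse-middle xs x y ys = begin
    reverse (xs ++ x ∷ y ∷ ys)         ≡⟨ reverse-++ xs (x ∷ y ∷ ys) ⟩
    reverse (x ∷ y ∷ ys) ++ reverse xs ≡⟨ cong (_++ reverse xs) (ʳ++-defn ys) ⟩
    (reverse ys ++ y ∷ x ∷ []) ++ reverse xs ≡⟨ ++-assoc (reverse ys) _ _ ⟩
    reverse ys ++ y ∷ x ∷ reverse xs   ∎
    where open ≡-Reasoning

  module _ {R : Rel A 0ℓ} where

    Linked-middle : ∀ xs {x y ys} → Linked R (xs ++ x ∷ y ∷ ys) → R x y
    Linked-middle []       (Rxy ∷ _) = Rxy
    Linked-middle (_ ∷ xs) l         = Linked-middle xs (Linked-tail l)

    Linked-lookup : ∀ x xs z → Linked R (x ∷ xs ++ [ z ]) →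
                    (i : Fin (length xs)) → R (lookup (x ∷ xs) (inject₁ i)) (lookup xs i)
    Linked-lookup x (y ∷ ys) z (Rxy ∷ _) zero    = Rxy
    Linked-lookup x (y ∷ ys) z (_   ∷ l) (suc i) = Linked-lookup y ys z l i

    Linked-lookup-last : ∀ x xs z → Linked R (x ∷ xs ++ [ z ]) →
                         R (lookup (x ∷ xs) (fromℕ (length xs))) z
    Linked-lookup-last x []       z (Rxz ∷ _) = Rxz
    Linked-lookup-last x (y ∷ ys) z (_   ∷ l) = Linked-lookup-last y ys z l

module Walks (G : Graph) where
  open Graph G

  _≺_ : Fin n → Fin m → Set
  _≺_ = Defs._≺_ G

  otherEndpoint-unique : ∀ {v w w′ e} → v ≺ e → w ≺ e → w′ ≺ e → w ≢ v → w′ ≢ v → w ≡ w′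
  otherEndpoint-unique (inj₁ refl) (inj₁ refl) _            w≢v _    = ⊥-elim (w≢v refl)
  otherEndpoint-unique (inj₁ refl) (inj₂ refl) (inj₁ refl) _   w′≢v = ⊥-elim (w′≢v refl)
  otherEndpoint-unique (inj₁ refl) (inj₂ refl) (inj₂ refl) _   _    = refl
  otherEndpoint-unique (inj₂ refl) (inj₂ refl) _            w≢v _    = ⊥-elim (w≢v refl)
  otherEndpoint-unique (inj₂ refl) (inj₁ refl) (inj₂ refl) _   w′≢v = ⊥-elim (w′≢v refl)
  otherEndpoint-unique (inj₂ refl) (inj₁ refl) (inj₁ refl) _   _    = refl

  edge-unique : ∀ {u w e e′} → u ≢ w → u ≺ e → w ≺ e → u ≺ e′ → w ≺ e′ → e ≡ e′
  edge-unique u≢w (inj₁ p) (inj₁ q) _ _ = ⊥-elim (u≢w (trans p (sym q)))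
  edge-unique u≢w (inj₂ p) (inj₂ q) _ _ = ⊥-elim (u≢w (trans p (sym q)))
  edge-unique u≢w _ _ (inj₁ p) (inj₁ q) = ⊥-elim (u≢w (trans p (sym q)))
  edge-unique u≢w _ _ (inj₂ p) (inj₂ q) = ⊥-elim (u≢w (trans p (sym q)))
  edge-unique {e = e} {e′} _ (inj₁ p) (inj₂ q) (inj₁ p′) (inj₂ q′) =
    noMulti e e′ (inj₁ (trans (sym p) p′ , trans (sym q) q′))
  edge-unique {e = e} {e′} _ (inj₁ p) (inj₂ q) (inj₂ p′) (inj₁ q′) =
    noMulti e e′ (inj₂ (trans (sym p) p′ , trans (sym q) q′))
  edge-unique {e = e} {e′} _ (inj₂ p) (inj₁ q) (inj₁ p′) (inj₂ q′) =
    noMulti e e′ (inj₂ (trans (sym q) q′ , trans (sym p) p′))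
  edge-unique {e = e} {e′} _ (inj₂ p) (inj₁ q) (inj₂ p′) (inj₁ q′) =
    noMulti e e′ (inj₁ (trans (sym q) q′ , trans (sym p) p′))

  Incident : Simplex G → Simplex G → Set
  Incident (inj₁ v) (inj₂ e) = v ≺ e
  Incident (inj₂ e) (inj₁ v) = v ≺ e
  Incident (inj₁ _) (inj₁ _) = ⊥
  Incident (inj₂ _) (inj₂ _) = ⊥

  Incident-sym : ∀ x y → Incident x y → Incident y x
  Incident-sym (inj₁ v) (inj₂ e) v≺e = v≺e
  Incident-sym (inj₂ e) (inj₁ v) v≺e = v≺e

  -- A walk in the barycentric subdivision of G that never turns back.
  NonBacktracking : List (Simplex G) → Set
  NonBacktracking []           = ⊤
  NonBacktracking (x ∷ [])     = ⊤
  NonBacktracking (x ∷ y ∷ zs) = Incident x y × NotHeadOf x zs × NonBacktracking (y ∷ zs)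

  NonBacktracking-tail : ∀ {x} xs → NonBacktracking (x ∷ xs) → NonBacktracking xs
  NonBacktracking-tail []      _            = tt
  NonBacktracking-tail (_ ∷ _) (_ , _ , nb) = nb

  NonBacktracking-++⁻ˡ : ∀ xs {ys} → NonBacktracking (xs ++ ys) → NonBacktracking xs
  NonBacktracking-++⁻ˡ []           _             = tt
  NonBacktracking-++⁻ˡ (x ∷ [])     _             = tt
  NonBacktracking-++⁻ˡ (x ∷ y ∷ zs) (i , x≢ , nb) =
    i , NotHeadOf-++⁻ˡ zs x≢ , NonBacktracking-++⁻ˡ (y ∷ zs) nb

  NonBacktracking-∷ʳ : ∀ x y zs u w → NonBacktracking (x ∷ y ∷ zs ++ [ u ]) →
                       Incident u w → w ∉ y ∷ zs → NonBacktracking (x ∷ y ∷ zs ++ u ∷ w ∷ [])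
  NonBacktracking-∷ʳ x y []       u w (i , x≢u , i′ , _) iuw w∉ =
    i , x≢u , i′ , (λ y≡w → w∉ (here (sym y≡w))) , iuw , tt , tt
  NonBacktracking-∷ʳ x y (z ∷ zs) u w (i , x≢z , nb) iuw w∉ =
    i , x≢z , NonBacktracking-∷ʳ y z zs u w nb iuw (w∉ ∘ there)

  NonBacktracking-ʳ++ : ∀ x xs ys → NonBacktracking (x ∷ xs) → NonBacktracking (x ∷ ys) →
                        HeadsDiffer xs ys → NonBacktracking (xs ʳ++ x ∷ ys)
  NonBacktracking-ʳ++ x []       ys _              nb′ _   = nb′
  NonBacktracking-ʳ++ x (y ∷ xs) ys (i , x≢ , nb) nb′ y≢ =
    NonBacktracking-ʳ++ y xs (x ∷ ys) nb (Incident-sym x y i , y≢ , nb′) (NotHeadOf⇒HeadsDiffer xs x≢)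

  NonBacktracking-reverse : ∀ xs → NonBacktracking xs → NonBacktracking (reverse xs)
  NonBacktracking-reverse []       _  = tt
  NonBacktracking-reverse (x ∷ xs) nb = NonBacktracking-ʳ++ x xs [] nb tt (HeadsDiffer-[] xs)

  vertices : List (Simplex G) → List (Fin n)
  vertices []            = []
  vertices (inj₁ v ∷ xs) = v ∷ vertices xs
  vertices (inj₂ _ ∷ xs) = vertices xs

  vertices-++ : ∀ xs ys → vertices (xs ++ ys) ≡ vertices xs ++ vertices ys
  vertices-++ []            ys = refl
  vertices-++ (inj₁ v ∷ xs) ys = cong (v ∷_) (vertices-++ xs ys)
  vertices-++ (inj₂ _ ∷ xs) ys = vertices-++ xs ys

  ∈-vertices⁻ : ∀ {v} xs → v ∈ vertices xs → inj₁ v ∈ xs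
  ∈-vertices⁻ (inj₁ _ ∷ xs) (here refl) = here refl
  ∈-vertices⁻ (inj₁ _ ∷ xs) (there v∈)  = there (∈-vertices⁻ xs v∈)
  ∈-vertices⁻ (inj₂ _ ∷ xs) v∈          = there (∈-vertices⁻ xs v∈)

  Unique-vertices : ∀ xs → Unique xs → Unique (vertices xs)
  Unique-vertices []            _         = []
  Unique-vertices (inj₁ v ∷ xs) (v∉ ∷ xs!) =
    ¬Any⇒All¬ _ (All¬⇒¬Any v∉ ∘ ∈-vertices⁻ xs) ∷ Unique-vertices xs xs!
  Unique-vertices (inj₂ _ ∷ xs) (_ ∷ xs!)  = Unique-vertices xs xs!

  Linked-vertices : ∀ xs → NonBacktracking xs → Linked (Adjacent G) (vertices xs)
  Linked-vertices []                               _                     = []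
  Linked-vertices (inj₂ _ ∷ xs)                    nb                    =
    Linked-vertices xs (NonBacktracking-tail xs nb)
  Linked-vertices (inj₁ v ∷ [])                    _                     = [-]
  Linked-vertices (inj₁ v ∷ inj₂ e ∷ [])           _                     = [-]
  Linked-vertices (inj₁ v ∷ inj₂ e ∷ inj₁ w ∷ xs) (v≺e , _ , w≺e , _ , nb) =
    (e , v≺e , w≺e) ∷ Linked-vertices (inj₁ w ∷ xs) nb
  Linked-vertices (inj₁ _ ∷ inj₁ _ ∷ _)            (() , _)
  Linked-vertices (inj₁ _ ∷ inj₂ _ ∷ inj₂ _ ∷ _)  (_ , _ , () , _)

  cycle : ∀ a b c vs → Unique (a ∷ b ∷ c ∷ vs) → Linked (Adjacent G) (a ∷ b ∷ c ∷ vs ++ [ a ]) → Cycle G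
  cycle a b c vs u l = record
    { k     = length vs
    ; vs    = lookup (a ∷ b ∷ c ∷ vs)
    ; inj   = Unique-lookup-injective u _ _
    ; adj   = Linked-lookup a (b ∷ c ∷ vs) a l
    ; close = Linked-lookup-last a (b ∷ c ∷ vs) a l
    }

  module _ (forest : Forest G) where

    -- Closed walks through fewer than three vertices turn back or use two
    -- parallel edges.
    ¬closedWalk-at-vertex : ∀ v xs → NonBacktracking (inj₁ v ∷ xs ++ [ inj₁ v ]) →
                            Unique (inj₁ v ∷ xs) → ⊥
    ¬closedWalk-at-vertex v [] (() , _) _
    ¬closedWalk-at-vertex v (inj₁ _ ∷ _) (() , _) _
    ¬closedWalk-at-vertex v (inj₂ _ ∷ []) (_ , v≢v , _) _ = v≢v refl
    ¬closedWalk-at-vertex v (inj₂ _ ∷ inj₂ _ ∷ _) (_ , _ , () , _) _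
    ¬closedWalk-at-vertex v (inj₂ _ ∷ inj₁ _ ∷ []) (_ , _ , _ , _ , () , _) _
    ¬closedWalk-at-vertex v (inj₂ _ ∷ inj₁ _ ∷ inj₁ _ ∷ _) (_ , _ , _ , _ , () , _) _
    ¬closedWalk-at-vertex v (inj₂ _ ∷ inj₁ _ ∷ inj₂ _ ∷ inj₂ _ ∷ _) (_ , _ , _ , _ , _ , _ , () , _) _
    ¬closedWalk-at-vertex v (inj₂ e₀ ∷ inj₁ v₁ ∷ inj₂ e₁ ∷ [])
      (v≺e₀ , v≢v₁ , v₁≺e₀ , _ , v₁≺e₁ , _ , v≺e₁ , _) (_ ∷ e₀∉ ∷ _) =
      All.lookup e₀∉ (there (here refl))
        (cong inj₂ (edge-unique (v≢v₁ ∘ cong inj₁) v≺e₀ v₁≺e₀ v≺e₁ v₁≺e₁))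
    ¬closedWalk-at-vertex v (inj₂ e₀ ∷ inj₁ v₁ ∷ inj₂ e₁ ∷ inj₁ v₂ ∷ xs) nb u =
      forest (cycle v v₁ v₂ (vertices xs) (Unique-vertices (inj₁ v ∷ _) u) linked)
      where
      linked : Linked (Adjacent G) (v ∷ v₁ ∷ v₂ ∷ vertices xs ++ [ v ])
      linked = subst (λ vs → Linked (Adjacent G) (v ∷ v₁ ∷ v₂ ∷ vs))
                     (vertices-++ xs [ inj₁ v ]) (Linked-vertices _ nb)

    -- Rotate the closed walk e, v₁, …, e to v₁, …, e, v₁.
    ¬closedWalk-at-edge : ∀ e xs → NonBacktracking (inj₂ e ∷ xs ++ [ inj₂ e ]) → Unique (inj₂ e ∷ xs) → ⊥
    ¬closedWalk-at-edge e [] (() , _) _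
    ¬closedWalk-at-edge e (inj₂ _ ∷ _) (() , _) _
    ¬closedWalk-at-edge e (inj₁ _ ∷ []) (_ , e≢e , _) _ = e≢e refl
    ¬closedWalk-at-edge e (inj₁ v₁ ∷ y ∷ xs) (v₁≺e , _ , nb) (e∉ ∷ u@(v₁∉ ∷ _)) =
      ¬closedWalk-at-vertex v₁ (y ∷ xs ++ [ inj₂ e ]) rotated-nb rotated-u
      where
      rotated-nb : NonBacktracking (inj₁ v₁ ∷ (y ∷ xs ++ [ inj₂ e ]) ++ [ inj₁ v₁ ])
      rotated-nb = subst (λ zs → NonBacktracking (inj₁ v₁ ∷ y ∷ zs))
                     (sym (++-assoc xs [ inj₂ e ] [ inj₁ v₁ ]))
                     (NonBacktracking-∷ʳ (inj₁ v₁) y xs (inj₂ e) (inj₁ v₁) nb v₁≺e (All¬⇒¬Any v₁∉))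
      rotated-u : Unique (inj₁ v₁ ∷ y ∷ xs ++ [ inj₂ e ])
      rotated-u = ++⁺ u (All.[] ∷ []) λ { (x∈ , here refl) → All.lookup e∉ x∈ refl }

    ¬closedWalk : ∀ x xs → NonBacktracking (x ∷ xs ++ [ x ]) → Unique (x ∷ xs) → ⊥
    ¬closedWalk (inj₁ v) = ¬closedWalk-at-vertex v
    ¬closedWalk (inj₂ e) = ¬closedWalk-at-edge e

    -- The first return to x closes a walk excluded by ¬closedWalk.
    NonBacktracking⇒Unique : ∀ xs → NonBacktracking xs → Unique xs
    NonBacktracking⇒Unique []       _  = []
    NonBacktracking⇒Unique (x ∷ xs) nb = ¬Any⇒All¬ xs x∉xs ∷ xs!
      where
      xs! : Unique xs
      xs! = NonBacktracking⇒Unique xs (NonBacktracking-tail xs nb)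
      x∉xs : x ∉ xs
      x∉xs x∈xs with ∈-∃++ x∈xs
      ... | ys , zs , refl =
        ¬closedWalk x ys (NonBacktracking-++⁻ˡ (x ∷ ys ++ [ x ]) nb′)
          (¬Any⇒All¬ ys (λ x∈ys → Unique-++⇒Disjoint ys xs! (x∈ys , here refl)) ∷ Unique-++⁻ˡ ys xs!)
        where
        nb′ : NonBacktracking ((x ∷ ys ++ [ x ]) ++ zs)
        nb′ = subst (λ ws → NonBacktracking (x ∷ ws)) (sym (++-assoc ys [ x ] zs)) nb

    branches-disjoint : ∀ x y ys z zs {w} → NonBacktracking (x ∷ y ∷ ys) → NonBacktracking (x ∷ z ∷ zs) →
                        y ≢ z → w ∈ y ∷ ys → w ∈ z ∷ zs → ⊥
    branches-disjoint x y ys z zs nb nb′ y≢z w∈ w∈′ =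
      Unique-++⇒Disjoint (reverse (y ∷ ys)) glued! (reverse⁺ w∈ , there w∈′)
      where
      glued! : Unique (reverse (y ∷ ys) ++ x ∷ z ∷ zs)
      glued! = subst Unique (ʳ++-defn (y ∷ ys))
                 (NonBacktracking⇒Unique _ (NonBacktracking-ʳ++ x (y ∷ ys) (z ∷ zs) nb nb′ y≢z))

    ¬shortcut : ∀ x y ys z → NonBacktracking (x ∷ z ∷ []) → NonBacktracking (x ∷ y ∷ ys ++ [ z ]) → ⊥
    ¬shortcut x y ys z nb nb′ with ≡-dec Fin._≟_ Fin._≟_ z y
    ... | yes refl = Unique[x∷xs]⇒x∉xs (NonBacktracking⇒Unique _ (NonBacktracking-tail _ nb′))
                                       (∈-++⁺ʳ ys (here refl))
    ... | no z≢y   = branches-disjoint x z [] y (ys ++ [ z ]) nb nb′ z≢y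
                                       (here refl) (there (∈-++⁺ʳ ys (here refl)))

    NonBacktracking-sameEnds : ∀ x xs ys z → NonBacktracking (x ∷ xs ++ [ z ]) →
                               NonBacktracking (x ∷ ys ++ [ z ]) → xs ≡ ys
    NonBacktracking-sameEnds x []       []        z _  _   = refl
    NonBacktracking-sameEnds x []       (y ∷ ys)  z nb nb′ = ⊥-elim (¬shortcut x y ys z nb nb′)
    NonBacktracking-sameEnds x (y ∷ xs) []        z nb nb′ = ⊥-elim (¬shortcut x y xs z nb′ nb)
    NonBacktracking-sameEnds x (y ∷ xs) (y′ ∷ ys) z nb nb′ with ≡-dec Fin._≟_ Fin._≟_ y y′
    ... | yes refl = cong (y ∷_) (NonBacktracking-sameEnds y xs ys z
                                    (NonBacktracking-tail _ nb) (NonBacktracking-tail _ nb′))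
    ... | no y≢y′  = ⊥-elim (branches-disjoint x y (xs ++ [ z ]) y′ (ys ++ [ z ]) nb nb′ y≢y′
                               (there (∈-++⁺ʳ xs (here refl))) (there (∈-++⁺ʳ ys (here refl))))

    NonBacktracking-reverse-sameEnds : ∀ x xs ys z → NonBacktracking (x ∷ xs ++ [ z ]) →
                                       NonBacktracking (z ∷ ys ++ [ x ]) →
                                       z ∷ ys ++ [ x ] ≡ reverse (x ∷ xs ++ [ z ])
    NonBacktracking-reverse-sameEnds x xs ys z nb nb′ = begin
      z ∷ ys ++ [ x ]                   ≡⟨ cong (λ ws → z ∷ ws ++ [ x ]) (sym (reverse-involutive ys)) ⟩
      z ∷ reverse (reverse ys) ++ [ x ] ≡⟨ cong (λ ws → z ∷ reverse ws ++ [ x ]) (sym xs≡ys⁻¹) ⟩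
      z ∷ reverse xs ++ [ x ]           ≡⟨ sym (reverse-ends x xs z) ⟩
      reverse (x ∷ xs ++ [ z ])         ∎
      where
      open ≡-Reasoning
      xs≡ys⁻¹ : xs ≡ reverse ys
      xs≡ys⁻¹ = NonBacktracking-sameEnds x xs (reverse ys) z nb
                  (subst NonBacktracking (reverse-ends z ys x) (NonBacktracking-reverse _ nb′))

module GradientPaths (O : TotalOrder 0ℓ 0ℓ 0ℓ) (G : Graph) where
  open Graph G
  open Morse O G
  open Walks G

  GradientStep : Fn → Simplex G → Simplex G → Set
  GradientStep f (inj₁ w) (inj₂ e) = InV f w e
  GradientStep f _        _        = ⊤

  ETail-steps : ∀ {f v e er} → InV f v e → (t : ETail f v e er) → Linked (GradientStep f) (inj₁ v ∷ ttrace f t)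
  ETail-steps inv (tstop _)          = inv ∷ [-]
  ETail-steps inv (tstep _ _ inv′ t) = inv ∷ tt ∷ ETail-steps inv′ t

  EPath-steps : ∀ {f a b} (p : EPath f a b) → Linked (GradientStep f) (etrace f p)
  EPath-steps (estop _)        = [-]
  EPath-steps (estart _ inv t) = tt ∷ ETail-steps inv t

  reversed-etrace-InV : ∀ {f a b} (q : EPath f b a) xs {e w} ys →
                        etrace f q ≡ reverse (xs ++ inj₂ e ∷ inj₁ w ∷ ys) → InV f w e
  reversed-etrace-InV q xs ys eq =
    Linked-middle (reverse ys)
      (subst (Linked (GradientStep _)) (trans eq (reverse-middle xs _ _ ys)) (EPath-steps q))

  ttrace-∷ʳ : ∀ {f v e er} (t : ETail f v e er) → ∃[ xs ] ttrace f t ≡ xs ++ [ inj₂ er ]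
  ttrace-∷ʳ (tstop _) = [] , refl
  ttrace-∷ʳ (tstep {e = e} {w = w} _ _ _ t) with xs , eq ← ttrace-∷ʳ t =
    inj₂ e ∷ inj₁ w ∷ xs , cong (λ ys → inj₂ e ∷ inj₁ w ∷ ys) eq

  ETail-target-noncritical : ∀ {f v e er} → InV f v e → ETail f v e er → ¬ CriticalEdge f er
  ETail-target-noncritical inv (tstop _)          er-critical = er-critical (_ , inv)
  ETail-target-noncritical _   (tstep _ _ inv′ t) er-critical = ETail-target-noncritical inv′ t er-critical

  NotHeadOf-ttrace : ∀ {f e w e′ er} → e ≢ e′ → (t : ETail f w e′ er) → NotHeadOf (inj₂ e) (ttrace f t)
  NotHeadOf-ttrace e≢e′ (tstop _)       = e≢e′ ∘ inj₂-injective
  NotHeadOf-ttrace e≢e′ (tstep _ _ _ _) = e≢e′ ∘ inj₂-injective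

  PassesThrough : Fin m → List (Simplex G) → Set
  PassesThrough e xs = ∃[ ys ] ∃[ w ] ∃[ zs ] xs ≡ ys ++ inj₂ e ∷ inj₁ w ∷ zs

  PassesThrough-∷ : ∀ {e xs} x → PassesThrough e xs → PassesThrough e (x ∷ xs)
  PassesThrough-∷ x (ys , w , zs , eq) = x ∷ ys , w , zs , cong (x ∷_) eq

  reversed-etrace-noncritical : ∀ {f a b e xs} (q : EPath f b a) →
                                etrace f q ≡ reverse xs → PassesThrough e xs → ¬ CriticalEdge f e
  reversed-etrace-noncritical q eq (ys , w , zs , refl) e-critical = e-critical (w , reversed-etrace-InV q ys zs eq)

  module _ {f : Fn} (isMorse : IsDiscreteMorse f) where
    open IsDiscreteMorse isMorse

    pairedVertex-unique : ∀ {v v′ e} → InV f v e → InV f v′ e → v ≡ v′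
    pairedVertex-unique (v≺e , e≤v) (v′≺e , e≤v′) = edgeCond _ _ _ v≺e e≤v v′≺e e≤v′

    pairedEdge-unique : ∀ {v e e′} → InV f v e → InV f v e′ → e ≡ e′
    pairedEdge-unique (v≺e , e≤v) (v≺e′ , e′≤v) = vertexCond _ _ _ v≺e e≤v v≺e′ e′≤v

    VPath-deterministic : ∀ {v u u′} → CriticalVertex f u → CriticalVertex f u′ →
                          (p : VPath f v u) (p′ : VPath f v u′) → u ≡ u′ × vtrace f p ≡ vtrace f p′
    VPath-deterministic _  _   (vstop _)            (vstop _)            = refl , refl
    VPath-deterministic cu _   (vstop _)            (vstep e inv _ _ _)  = ⊥-elim (cu (e , inv))
    VPath-deterministic _  cu′ (vstep e inv _ _ _)  (vstop _)            = ⊥-elim (cu′ (e , inv))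
    VPath-deterministic cu cu′ (vstep {v} e inv w≺e w≢v p) (vstep e′ inv′ w′≺e′ w′≢v p′)
      with pairedEdge-unique inv inv′
    ... | refl with otherEndpoint-unique (proj₁ inv) w≺e w′≺e′ w≢v w′≢v
    ... | refl = Product.map₂ (cong (λ xs → inj₁ v ∷ inj₂ e ∷ xs)) (VPath-deterministic cu cu′ p p′)

    nextEdge-≢ : ∀ {v e w e′} → InV f v e → w ≺ e → w ≢ v → InV f w e′ → e ≢ e′
    nextEdge-≢ inv w≺e w≢v inv′ refl = w≢v (sym (pairedVertex-unique inv (w≺e , proj₂ inv′)))

    ETail-NonBacktracking : ∀ {v e er} → InV f v e → (t : ETail f v e er) → NonBacktracking (inj₁ v ∷ ttrace f t)
    ETail-NonBacktracking inv (tstop _)              = proj₁ inv , tt , tt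
    ETail-NonBacktracking inv (tstep w≺e w≢v inv′ t) =
      proj₁ inv , w≢v ∘ sym ∘ inj₁-injective , w≺e ,
      NotHeadOf-ttrace (nextEdge-≢ inv w≺e w≢v inv′) t , ETail-NonBacktracking inv′ t

    EPath-NonBacktracking : ∀ {a b} → CriticalEdge f a → (p : EPath f a b) → NonBacktracking (etrace f p)
    EPath-NonBacktracking _ (estop _) = tt
    EPath-NonBacktracking {a} ca (estart {e₁ = e₁} v≺a inv t) =
      v≺a , NotHeadOf-ttrace a≢e₁ t , ETail-NonBacktracking inv t
      where
      a≢e₁ : a ≢ e₁
      a≢e₁ refl = ca (_ , v≺a , proj₂ inv)

    tails-comparable : ∀ {v e b c} → InV f v e → (t : ETail f v e b) (t′ : ETail f v e c) →
                       b ≡ c ⊎ PassesThrough b (ttrace f t′) ⊎ PassesThrough c (ttrace f t)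
    tails-comparable _   (tstop _) (tstop _) = inj₁ refl
    tails-comparable _   (tstop _) (tstep {w = w} _ _ _ t′) = inj₂ (inj₁ ([] , w , ttrace f t′ , refl))
    tails-comparable _   (tstep {w = w} _ _ _ t) (tstop _)  = inj₂ (inj₂ ([] , w , ttrace f t , refl))
    tails-comparable inv (tstep {e = e} {w = w} w≺e w≢v inv₁ t) (tstep w′≺e w′≢v inv₂ t′)
      with otherEndpoint-unique (proj₁ inv) w≺e w′≺e w≢v w′≢v
    ... | refl with pairedEdge-unique inv₁ inv₂
    ... | refl = Sum.map₂ (Sum.map extend extend) (tails-comparable inv₁ t t′)
      where
      extend : ∀ {e′ xs} → PassesThrough e′ xs → PassesThrough e′ (inj₂ e ∷ inj₁ w ∷ xs)
      extend = PassesThrough-∷ (inj₂ e) ∘ PassesThrough-∷ (inj₁ w)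

  module _ (forest : Forest G) where

    etrace-unique : ∀ {f a b} → IsDiscreteMorse f → CriticalEdge f a →
                   (p p′ : EPath f a b) → etrace f p ≡ etrace f p′
    etrace-unique _   _  (estop _)        (estop _)        = refl
    etrace-unique _   ca (estop _)        (estart _ inv t) = ⊥-elim (ETail-target-noncritical inv t ca)
    etrace-unique _   ca (estart _ inv t) (estop _)        = ⊥-elim (ETail-target-noncritical inv t ca)
    etrace-unique {a = a} {b} isM ca p@(estart {v = v} _ _ t) p′@(estart {v = v′} _ _ t′)
      with ttrace-∷ʳ t | ttrace-∷ʳ t′ | EPath-NonBacktracking isM ca p | EPath-NonBacktracking isM ca p′
    ... | xs , eq | xs′ , eq′ | nb | nb′ rewrite eq | eq′ =
      cong (λ ys → inj₂ a ∷ ys ++ [ inj₂ b ])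
           (NonBacktracking-sameEnds forest (inj₂ a) (inj₁ v ∷ xs) (inj₁ v′ ∷ xs′) (inj₂ b) nb nb′)

    etrace-reverse : ∀ {f g a b} → IsDiscreteMorse f → IsDiscreteMorse g → CriticalEdge f a → CriticalEdge g b →
                    (p : EPath f a b) (q : EPath g b a) → etrace g q ≡ reverse (etrace f p)
    etrace-reverse _ _ _  _  (estop _)        (estop _)        = refl
    etrace-reverse _ _ _  cb (estop _)        (estart _ inv t) = ⊥-elim (ETail-target-noncritical inv t cb)
    etrace-reverse _ _ ca _  (estart _ inv t) (estop _)        = ⊥-elim (ETail-target-noncritical inv t ca)
    etrace-reverse {a = a} {b} isf isg ca cb p@(estart {v = v} _ _ t) q@(estart {v = v′} _ _ t′)
      with ttrace-∷ʳ t | ttrace-∷ʳ t′ | EPath-NonBacktracking isf ca p | EPath-NonBacktracking isg cb q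
    ... | xs , eq | xs′ , eq′ | nb | nb′ rewrite eq | eq′ =
      NonBacktracking-reverse-sameEnds forest (inj₂ a) (inj₁ v ∷ xs) (inj₁ v′ ∷ xs′) (inj₂ b) nb nb′

    partner-unique : ∀ {f g a b c} → IsDiscreteMorse f → IsDiscreteMorse g →
                     CriticalEdge f a → CriticalEdge g b → CriticalEdge g c →
                     EPath f a b → EPath f a c → EPath g b a → EPath g c a → b ≡ c
    partner-unique _ _ _ _  _  _ _ (estop _)        (estop _)        = refl
    partner-unique _ _ _ cb _  _ _ (estop _)        (estart _ inv t) = ⊥-elim (ETail-target-noncritical inv t cb)
    partner-unique _ _ _ _  cc _ _ (estart _ inv t) (estop _)        = ⊥-elim (ETail-target-noncritical inv t cc)
    partner-unique _ _ _ cb _  (estop _) _ (estart _ inv t) (estart _ _ _) =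
      ⊥-elim (ETail-target-noncritical inv t cb)
    partner-unique _ _ _ _  cc (estart _ _ _) (estop _) (estart _ _ _) (estart _ inv t) =
      ⊥-elim (ETail-target-noncritical inv t cc)
    -- Read backwards, qb and qc end by pairing a with the first vertex of pb,
    -- resp. pc; so these first vertices coincide.
    partner-unique isf isg ca cb cc
      pb@(estart {v = x} _ invb tb) pc@(estart {v = x′} _ invc tc) qb@(estart _ _ _) qc@(estart _ _ _)
      with pairedVertex-unique isg (reversed-etrace-InV qb [] {w = x} (ttrace _ tb) (etrace-reverse isf isg ca cb pb qb))
                                   (reversed-etrace-InV qc [] {w = x′} (ttrace _ tc) (etrace-reverse isf isg ca cc pc qc))
    ... | refl with pairedEdge-unique isf invb invc
    ... | refl with tails-comparable isf invb tb tc
    ... | inj₁ b≡c = b≡c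
    ... | inj₂ (inj₁ c-beyond-b) = ⊥-elim (reversed-etrace-noncritical qc (etrace-reverse isf isg ca cc pc qc)
                                             (PassesThrough-∷ _ (PassesThrough-∷ _ c-beyond-b)) cb)
    ... | inj₂ (inj₂ b-beyond-c) = ⊥-elim (reversed-etrace-noncritical qb (etrace-reverse isf isg ca cb pb qb)
                                             (PassesThrough-∷ _ (PassesThrough-∷ _ b-beyond-c)) cc)

lemma4p6 : (O : TotalOrder 0ℓ 0ℓ 0ℓ) (G : Graph) → Forest G
    → (f₁ f₂ : Morse.Fn O G)
    → Morse.IsDiscreteMorse O G f₁ → Morse.IsDiscreteMorse O G f₂
    → Morse.Excellent O G f₁ → Morse.Excellent O G f₂
    → (q : Fin 2) (σ₁ σ₂ : Cell G q)
    → Morse.Critical O G f₁ q σ₁ → Morse.Critical O G f₂ q σ₂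
    → Morse.StronglyConnected O G f₁ f₂ q σ₁ σ₂
    → ((τ₂ : Cell G q) → Morse.Critical O G f₂ q τ₂
         → Morse.StronglyConnected O G f₁ f₂ q σ₁ τ₂ → τ₂ ≡ σ₂)
      × ((τ₁ : Cell G q) → Morse.Critical O G f₁ q τ₁
         → Morse.StronglyConnected O G f₁ f₂ q τ₁ σ₂ → τ₁ ≡ σ₁)
      × ((p p' : Morse.Path₁₂ O G f₁ f₂ q σ₁ σ₂)
         → Morse.trace₁₂ O G f₁ f₂ q p ≡ Morse.trace₁₂ O G f₁ f₂ q p')
      × ((p p' : Morse.Path₂₁ O G f₁ f₂ q σ₁ σ₂)
         → Morse.trace₂₁ O G f₁ f₂ q p ≡ Morse.trace₂₁ O G f₁ f₂ q p')
lemma4p6 O G _ f₁ f₂ m₁ m₂ _ _ zero σ₁ σ₂ c₁ c₂ (_ , _ , p₁₂ , p₂₁) =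
    (λ τ₂ cτ₂ (_ , _ , p₁τ , _) → proj₁ (VPath-deterministic m₂ cτ₂ c₂ p₁τ p₁₂))
  , (λ τ₁ cτ₁ (_ , _ , _ , pτ₁) → proj₁ (VPath-deterministic m₁ cτ₁ c₁ pτ₁ p₂₁))
  , (λ p p′ → proj₂ (VPath-deterministic m₂ c₂ c₂ p p′))
  , (λ p p′ → proj₂ (VPath-deterministic m₁ c₁ c₁ p p′))
  where open GradientPaths O G
lemma4p6 O G forest f₁ f₂ m₁ m₂ _ _ (suc zero) σ₁ σ₂ c₁ c₂ (_ , _ , p₁₂ , p₂₁) =
    (λ τ₂ cτ₂ (_ , _ , p₁τ , pτ₁) → partner-unique forest m₁ m₂ c₁ cτ₂ c₂ p₁τ p₁₂ pτ₁ p₂₁)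
  , (λ τ₁ cτ₁ (_ , _ , pτ₂ , p₂τ) → partner-unique forest m₂ m₁ c₂ cτ₁ c₁ p₂τ p₂₁ pτ₂ p₁₂)
  , etrace-unique forest m₁ c₁
  , etrace-unique forest m₂ c₂
  where open GradientPaths O G
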